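{- Let $\Omega$ be an SMT formula written as $\Omega = \Psi \wedge \Phi$, where $\Psi$ is its Boolean skeleton over Boolean skeleton variables and $\Phi$ is the set of consistency constraints. Fix an ordering $P_1, \ldots, P_r$ of the Boolean skeleton variables, and let $\theta_1, \ldots, \theta_n$ be symmetries of $\Psi \wedge \Phi$. For each symmetry $\theta$, define the restricted symmetry breaking predicate $$SBP(\theta) \;=\; \bigwedge_{1 \le i \le r} \Big( \big(\textstyle\bigwedge_{1 \le j < i} P_j \leftrightarrow \theta(P_j)\big) \Rightarrow \big(P_i \Rightarrow \theta(P_i)\big)\Big),$$ and set $\Psi' = \Psi \wedge SBP(\theta_1) \wedge \cdots \wedge SBP(\theta_n)$. Then $\Psi' \wedge \Phi$ and $\Psi \wedge \Phi$ are equisatisfiable, i.e. one is satisfiable if and only if the other is.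
   Context: An SMT formula combines operations (arithmetic, comparisons, equalities, etc.) over typed non-Boolean theory variables (e.g. integers, reals) with Boolean connectives. Its Boolean skeleton $\Psi$ is obtained by replacing each atomic Boolean expression (e.g. $x+y>2$) by a fresh Boolean variable (a Boolean skeleton variable); the consistency constraints $\Phi$ are the conjunction of the equivalences $P \Leftrightarrow a$ linking each Boolean skeleton variable $P$ to the atomic expression $a$ it replaces. Thus $\Omega$ is satisfiable iff $\Psi\wedge\Phi$ is satisfiable. A symmetry of $\Psi \wedge \Phi$ is a permutation $\theta$ acting simultaneously on the Boolean skeleton variables and the theory variables, mapping each variable to a variable of the same type, such that simultaneously replacing every variable $v$ in $\Psi \wedge \Phi$ by $\theta(v)$ yields $\Psi \wedge \Phi$ again (the same set of constraints). The same ordering $P_1,\dots,P_r$ is used for all the symmetries $\theta_1,\dots,\theta_n$. -}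

module Defs where

open import Data.Bool using (Bool; true; false; not; _∧_; _∨_)
open import Data.Fin using (Fin; _<?_)
open import Data.Fin.Permutation using (Permutation′; _⟨$⟩ʳ_)
open import Data.List using (List; []; _∷_; map; _++_; allFin; filter; foldr)
open import Data.List.Membership.Propositional using (_∈_)
open import Data.List.Relation.Unary.All using (All)
open import Data.Product using (Σ; _×_; ∃)
open import Data.Nat using (ℕ)
open import Function.Bundles using (_↔_; Inverse)
open import Relation.Binary.PropositionalEquality using (_≡_)

-- The only assumed law is the usual substitution/renaming lemma, which
-- holds for any syntactic notion of atomic expression.

record Theory : Set₁ where
  field
    Sort   : Set
    Var    : Sort → Set
    Dom    : Sort → Set
    Atom   : Set
    rename : (∀ s → Var s → Var s) → Atom → Atom
    eval   : (∀ s → Var s → Dom s) → Atom → Bool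
    eval-rename : ∀ (σ : ∀ s → Var s → Var s) (ρ : ∀ s → Var s → Dom s) (a : Atom) →
                  eval ρ (rename σ a) ≡ eval (λ s x → ρ s (σ s x)) a

-- Propositional formulas over the Boolean skeleton variables P_1..P_r
-- (represented as Fin r, ordered by the order of Fin r).

data Formula (r : ℕ) : Set where
  var  : Fin r → Formula r
  tt   : Formula r
  ff   : Formula r
  ¬ᶠ_  : Formula r → Formula r
  _∧ᶠ_ : Formula r → Formula r → Formula r
  _∨ᶠ_ : Formula r → Formula r → Formula r
  _⇒ᶠ_ : Formula r → Formula r → Formula r
  _⇔ᶠ_ : Formula r → Formula r → Formula r

_⇒ᵇ_ : Bool → Bool → Bool
a ⇒ᵇ b = not a ∨ b

_⇔ᵇ_ : Bool → Bool → Bool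
a ⇔ᵇ b = (a ⇒ᵇ b) ∧ (b ⇒ᵇ a)

⟦_⟧ : ∀ {r} → Formula r → (Fin r → Bool) → Bool
⟦ var i ⟧ β = β i
⟦ tt ⟧ β = true
⟦ ff ⟧ β = false
⟦ ¬ᶠ φ ⟧ β = not (⟦ φ ⟧ β)
⟦ φ ∧ᶠ ψ ⟧ β = ⟦ φ ⟧ β ∧ ⟦ ψ ⟧ β
⟦ φ ∨ᶠ ψ ⟧ β = ⟦ φ ⟧ β ∨ ⟦ ψ ⟧ β
⟦ φ ⇒ᶠ ψ ⟧ β = ⟦ φ ⟧ β ⇒ᵇ ⟦ ψ ⟧ β
⟦ φ ⇔ᶠ ψ ⟧ β = ⟦ φ ⟧ β ⇔ᵇ ⟦ ψ ⟧ β

renameF : ∀ {r} → (Fin r → Fin r) → Formula r → Formula r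
renameF π (var i) = var (π i)
renameF π tt = tt
renameF π ff = ff
renameF π (¬ᶠ φ) = ¬ᶠ renameF π φ
renameF π (φ ∧ᶠ ψ) = renameF π φ ∧ᶠ renameF π ψ
renameF π (φ ∨ᶠ ψ) = renameF π φ ∨ᶠ renameF π ψ
renameF π (φ ⇒ᶠ ψ) = renameF π φ ⇒ᶠ renameF π ψ
renameF π (φ ⇔ᶠ ψ) = renameF π φ ⇔ᶠ renameF π ψ

⋀ : ∀ {r} → List (Formula r) → Formula r
⋀ = foldr _∧ᶠ_ tt

module _ (T : Theory) where
  open Theory T

  -- A constraint is either a Boolean-skeleton constraint or a
  -- consistency constraint  P_k ⇔ a.
  data Constraint (r : ℕ) : Set where
    skel : Formula r → Constraint r
    link : Fin r → Atom → Constraint r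

  -- Ψ : the Boolean skeleton (a list of propositional constraints, read
  --     conjunctively), atom : the atomic expression replaced by each P_k.
  record SMT (r : ℕ) : Set where
    constructor smt
    field
      Ψ    : List (Formula r)
      atom : Fin r → Atom

  Φ : ∀ {r} → (Fin r → Atom) → List (Constraint r)
  Φ atom = map (λ k → link k (atom k)) (allFin _)

  constraints : ∀ {r} → List (Formula r) → (Fin r → Atom) → List (Constraint r)
  constraints Ψ atom = map skel Ψ ++ Φ atom

  Valuation : Set
  Valuation = ∀ s → Var s → Dom s

  holds : ∀ {r} → (Fin r → Bool) → Valuation → Constraint r → Set
  holds β ρ (skel φ) = ⟦ φ ⟧ β ≡ true
  holds β ρ (link k a) = β k ≡ eval ρ a

  Satisfiable : ∀ {r} → List (Constraint r) → Set
  Satisfiable {r} cs = Σ (Fin r → Bool) λ β → Σ Valuation λ ρ → All (holds β ρ) cs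

  record VarPerm (r : ℕ) : Set where
    field
      π : Permutation′ r
      σ : ∀ s → Var s ↔ Var s

    πf : Fin r → Fin r
    πf i = π ⟨$⟩ʳ i

    σf : ∀ s → Var s → Var s
    σf s = Inverse.to (σ s)

  open VarPerm public

  applyC : ∀ {r} → VarPerm r → Constraint r → Constraint r
  applyC θ (skel φ) = skel (renameF (πf θ) φ)
  applyC θ (link k a) = link (πf θ k) (rename (σf θ) a)

  _≈ˢ_ : ∀ {r} → List (Constraint r) → List (Constraint r) → Set
  xs ≈ˢ ys = (∀ c → c ∈ xs → c ∈ ys) × (∀ c → c ∈ ys → c ∈ xs)

  IsSymmetry : ∀ {r} → SMT r → VarPerm r → Set
  IsSymmetry (smt Ψ atom) θ =
    map (applyC θ) (constraints Ψ atom) ≈ˢ constraints Ψ atom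

  SBP : ∀ {r} → VarPerm r → Formula r
  SBP {r} θ = ⋀ (map clause (allFin r))
    where
      clause : Fin r → Formula r
      clause i = ⋀ (map (λ j → var j ⇔ᶠ var (πf θ j)) (filter (_<? i) (allFin r)))
                 ⇒ᶠ (var i ⇒ᶠ var (πf θ i))

-- Read an assignment β of P_1..P_r as the binary number β(P_1)…β(P_r), P_1 most
-- significant. If β violates SBP(θ), its first violated clause i has β and β ∘ θ
-- agreeing before i with β(P_i) = 1 and β(θ(P_i)) = 0, so the assignment β ∘ θ,
-- which together with the theory valuation moved by θ is again a model of Ψ ∧ Φ
-- since θ is a symmetry, has a strictly smaller number. Descending from any model
-- of Ψ ∧ Φ therefore ends at a model satisfying every SBP(θ_k).
module Submission where

open import Defs
open import Data.Nat using (ℕ)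
open import Data.Fin using (Fin)
open import Data.List using (map; tabulate; _++_)
open import Function.Bundles using (_⇔_)

open import Data.Bool using (Bool; true; false; not; _∧_; _∨_; if_then_else_; _≟_)
open import Data.Bool.Properties using (¬-not)
open import Data.Nat using (zero; suc; _+_; _^_; _<_; z<s; s<s)
open import Data.Nat.Properties using (<-≤-trans; m≤m+n; +-monoʳ-<)
open import Data.Nat.Induction using (<-wellFounded)
open import Data.Fin using (_<?_) renaming (zero to fzero; suc to fsuc; _<_ to _<ᶠ_)
open import Data.Fin.Properties using (all?; ¬∀⟶∃¬)
open import Data.List using (List; _∷_; allFin; filter)
open import Data.List.Membership.Propositional using (_∈_)
open import Data.List.Membership.Propositional.Properties using (∈-map⁺; ∈-filter⁺; ∈-allFin)
open import Data.List.Relation.Unary.Any using (here; there)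
open import Data.List.Relation.Unary.All using (All; lookup) renaming (tabulate to tabulateᴬ)
open import Data.List.Relation.Unary.All.Properties using (++⁺; ++⁻ˡ; ++⁻ʳ; map⁺; map⁻; tabulate⁺)
open import Data.Product using (Σ; ∃₂; _×_; _,_)
open import Function using (_∘_)
open import Function.Bundles using (mk⇔)
open import Induction.WellFounded using (Acc; acc)
open import Relation.Binary.PropositionalEquality using (_≡_; refl; sym; trans; cong; cong₂)
open import Relation.Nullary using (yes; no)

⇒ᵇ-false : ∀ {a b} → (a ⇒ᵇ b) ≡ false → a ≡ true × b ≡ false
⇒ᵇ-false {true} {false} _ = refl , refl

⇔ᵇ-true : ∀ {a b} → (a ⇔ᵇ b) ≡ true → a ≡ b
⇔ᵇ-true {true} {true} _ = refl
⇔ᵇ-true {false} {false} _ = refl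

⟦renameF⟧ : ∀ {r} (π : Fin r → Fin r) (φ : Formula r) (β : Fin r → Bool) →
            ⟦ renameF π φ ⟧ β ≡ ⟦ φ ⟧ (β ∘ π)
⟦renameF⟧ π (var i) β = refl
⟦renameF⟧ π tt β = refl
⟦renameF⟧ π ff β = refl
⟦renameF⟧ π (¬ᶠ φ) β = cong not (⟦renameF⟧ π φ β)
⟦renameF⟧ π (φ ∧ᶠ ψ) β = cong₂ _∧_ (⟦renameF⟧ π φ β) (⟦renameF⟧ π ψ β)
⟦renameF⟧ π (φ ∨ᶠ ψ) β = cong₂ _∨_ (⟦renameF⟧ π φ β) (⟦renameF⟧ π ψ β)
⟦renameF⟧ π (φ ⇒ᶠ ψ) β = cong₂ _⇒ᵇ_ (⟦renameF⟧ π φ β) (⟦renameF⟧ π ψ β)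
⟦renameF⟧ π (φ ⇔ᶠ ψ) β = cong₂ _⇔ᵇ_ (⟦renameF⟧ π φ β) (⟦renameF⟧ π ψ β)

⟦⋀-map⟧-true : ∀ {r} {A : Set} (f : A → Formula r) (xs : List A) (β : Fin r → Bool) →
               ⟦ ⋀ (map f xs) ⟧ β ≡ true → ∀ {x} → x ∈ xs → ⟦ f x ⟧ β ≡ true
⟦⋀-map⟧-true f (x ∷ xs) β h x∈ with ⟦ f x ⟧ β in eq | x∈
... | true | here refl = eq
... | true | there x∈xs = ⟦⋀-map⟧-true f xs β h x∈xs

⟦⋀-map⟧-false : ∀ {r} {A : Set} (f : A → Formula r) (xs : List A) (β : Fin r → Bool) →
                ⟦ ⋀ (map f xs) ⟧ β ≡ false → Σ A λ x → x ∈ xs × ⟦ f x ⟧ β ≡ false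
⟦⋀-map⟧-false f (x ∷ xs) β h with ⟦ f x ⟧ β in eq
... | false = x , here refl , eq
... | true with ⟦⋀-map⟧-false f xs β h
... | y , y∈xs , fy = y , there y∈xs , fy

rank : ∀ {r} → (Fin r → Bool) → ℕ
rank {zero} β = 0
rank {suc r} β = (if β fzero then 2 ^ r else 0) + rank (β ∘ fsuc)

rank<2^ : ∀ {r} (β : Fin r → Bool) → rank β < 2 ^ r
rank<2^ {zero} β = z<s
rank<2^ {suc r} β with β fzero
... | true = +-monoʳ-< (2 ^ r) (<-≤-trans (rank<2^ (β ∘ fsuc)) (m≤m+n _ 0))
... | false = <-≤-trans (rank<2^ (β ∘ fsuc)) (m≤m+n _ _)

rank-<-lex : ∀ {r} (β γ : Fin r → Bool) (i : Fin r) → (∀ j → j <ᶠ i → β j ≡ γ j) →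
             β i ≡ true → γ i ≡ false → rank γ < rank β
rank-<-lex {suc r} β γ fzero _ βi γi rewrite βi | γi =
  <-≤-trans (rank<2^ (γ ∘ fsuc)) (m≤m+n _ _)
rank-<-lex {suc r} β γ (fsuc i) agree βi γi rewrite agree fzero z<s =
  +-monoʳ-< (if γ fzero then 2 ^ r else 0)
    (rank-<-lex (β ∘ fsuc) (γ ∘ fsuc) i (λ j j<i → agree (fsuc j) (s<s j<i)) βi γi)

module _ (T : Theory) where
  open Theory T

  SBP-false⇒rank-< : ∀ {r} (θ : VarPerm T r) (β : Fin r → Bool) →
                     ⟦ SBP T θ ⟧ β ≡ false → rank (β ∘ πf θ) < rank β
  SBP-false⇒rank-< {r} θ β sbp with ⟦⋀-map⟧-false clause (allFin r) β sbp
    where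
      prefix : Fin r → Formula r
      prefix i = ⋀ (map (λ j → var j ⇔ᶠ var (πf θ j)) (filter (_<? i) (allFin r)))
      clause : Fin r → Formula r
      clause i = prefix i ⇒ᶠ (var i ⇒ᶠ var (πf θ i))
  ... | i , _ , clauseᵢ with ⇒ᵇ-false clauseᵢ
  ... | prefixᵢ , βᵢ⇒βθᵢ with ⇒ᵇ-false βᵢ⇒βθᵢ
  ... | βᵢ , βθᵢ = rank-<-lex β (β ∘ πf θ) i agree βᵢ βθᵢ
    where
      agree : ∀ j → j <ᶠ i → β j ≡ β (πf θ j)
      agree j j<i = ⇔ᵇ-true (⟦⋀-map⟧-true (λ j → var j ⇔ᶠ var (πf θ j)) _ β prefixᵢ
                               (∈-filter⁺ (_<? i) (∈-allFin j) j<i))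

  Model : ∀ {r} → List (Formula r) → (Fin r → Atom) → (Fin r → Bool) → Valuation T → Set
  Model Ψ atom β ρ = All (holds T β ρ) (constraints T Ψ atom)

  Model-++⁺ : ∀ {r} (Ψ Ψ′ : List (Formula r)) atom β ρ → Model Ψ atom β ρ →
              All (λ φ → ⟦ φ ⟧ β ≡ true) Ψ′ → Model (Ψ ++ Ψ′) atom β ρ
  Model-++⁺ Ψ Ψ′ atom β ρ ⊨Ω ⊨Ψ′ =
    ++⁺ (map⁺ (++⁺ (map⁻ (++⁻ˡ (map skel Ψ) ⊨Ω)) ⊨Ψ′)) (++⁻ʳ (map skel Ψ) ⊨Ω)

  Model-++⁻ : ∀ {r} (Ψ Ψ′ : List (Formula r)) atom β ρ →
              Model (Ψ ++ Ψ′) atom β ρ → Model Ψ atom β ρ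
  Model-++⁻ Ψ Ψ′ atom β ρ ⊨Ω′ =
    ++⁺ (map⁺ (++⁻ˡ Ψ (map⁻ (++⁻ˡ (map skel (Ψ ++ Ψ′)) ⊨Ω′)))) (++⁻ʳ (map skel (Ψ ++ Ψ′)) ⊨Ω′)

  holds-applyC : ∀ {r} (θ : VarPerm T r) (β : Fin r → Bool) (ρ : Valuation T) (c : Constraint T r) →
                 holds T β ρ (applyC T θ c) → holds T (β ∘ πf θ) (λ s → ρ s ∘ σf θ s) c
  holds-applyC θ β ρ (skel φ) h = trans (sym (⟦renameF⟧ (πf θ) φ β)) h
  holds-applyC θ β ρ (link k a) h = trans h (eval-rename (σf θ) ρ a)

  Model-symmetry : ∀ {r} Ψ atom (θ : VarPerm T r) → IsSymmetry T (smt Ψ atom) θ →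
                   ∀ β ρ → Model Ψ atom β ρ → Model Ψ atom (β ∘ πf θ) (λ s → ρ s ∘ σf θ s)
  Model-symmetry Ψ atom θ (θ⊆ , _) β ρ ⊨Ω = tabulateᴬ λ {c} c∈ →
    holds-applyC θ β ρ c (lookup ⊨Ω (θ⊆ _ (∈-map⁺ (applyC T θ) c∈)))

  Model-SBP : ∀ {r n} Ψ atom (θ : Fin n → VarPerm T r) → (∀ k → IsSymmetry T (smt Ψ atom) (θ k)) →
              ∀ β ρ → Acc _<_ (rank β) → Model Ψ atom β ρ →
              ∃₂ λ β′ ρ′ → Model Ψ atom β′ ρ′ × (∀ k → ⟦ SBP T (θ k) ⟧ β′ ≡ true)
  Model-SBP {n = n} Ψ atom θ isSym β ρ (acc smaller) ⊨Ω
    with all? (λ k → ⟦ SBP T (θ k) ⟧ β ≟ true)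
  ... | yes ⊨SBP = β , ρ , ⊨Ω , ⊨SBP
  ... | no ⊭SBP with ¬∀⟶∃¬ n _ (λ k → ⟦ SBP T (θ k) ⟧ β ≟ true) ⊭SBP
  ... | k , ⊭SBPₖ =
    Model-SBP Ψ atom θ isSym _ _ (smaller (SBP-false⇒rank-< (θ k) β (¬-not ⊭SBPₖ)))
      (Model-symmetry Ψ atom (θ k) (isSym k) β ρ ⊨Ω)

theorem2 : (T : Theory) (r n : ℕ) (Ω : SMT T r) (θ : Fin n → VarPerm T r) →
           (∀ k → IsSymmetry T Ω (θ k)) →
           Satisfiable T (constraints T (SMT.Ψ Ω ++ tabulate (λ k → SBP T (θ k))) (SMT.atom Ω))
             ⇔ Satisfiable T (constraints T (SMT.Ψ Ω) (SMT.atom Ω))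
theorem2 T r n (smt Ψ atom) θ isSym = mk⇔ weaken strengthen
  where
    SBPs : List (Formula r)
    SBPs = tabulate (λ k → SBP T (θ k))

    weaken : Satisfiable T (constraints T (Ψ ++ SBPs) atom) → Satisfiable T (constraints T Ψ atom)
    weaken (β , ρ , ⊨Ω′) = β , ρ , Model-++⁻ T Ψ SBPs atom β ρ ⊨Ω′

    strengthen : Satisfiable T (constraints T Ψ atom) → Satisfiable T (constraints T (Ψ ++ SBPs) atom)
    strengthen (β , ρ , ⊨Ω) with Model-SBP T Ψ atom θ isSym β ρ (<-wellFounded (rank β)) ⊨Ω
    ... | β′ , ρ′ , ⊨Ω′ , ⊨SBP = β′ , ρ′ , Model-++⁺ T Ψ SBPs atom β′ ρ′ ⊨Ω′ (tabulate⁺ ⊨SBP)
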